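{- For every $m\ge 2$, each row of $CT_m$ is a row of the Sylvester Hadamard matrix $H_{2^{m-1}}$.
   Context: Sylvester Hadamard matrices: $H_2=\begin{bmatrix}1&1\\1&-1\end{bmatrix}$ and $H_{2^k}=\begin{bmatrix}H_{2^{k-1}}&H_{2^{k-1}}\\ H_{2^{k-1}}&-H_{2^{k-1}}\end{bmatrix}$ for $k\ge2$. The matrices $T_m$ ($m\times 2^{m-1}$) are defined recursively by $T_1=[1]$ and $T_{m+1}=\begin{bmatrix} T_m & T_m\\ 1\cdots 1 & -1\cdots -1\end{bmatrix}$, where the last row consists of $2^{m-1}$ ones followed by $2^{m-1}$ minus ones. For $v=(v_1,\dots,v_m)\in\mathbb{R}^m$, its Column Pairwise Product is $v'=(v_1v_2, v_1v_3, v_2v_3, v_1v_4,\dots, v_1v_m,\dots,v_{m-1}v_m)\in\mathbb{R}^{m(m-1)/2}$ (for $i<j$ the entry $v_iv_j$ is in position $\frac{(j-1)(j-2)}{2}+i$). $CT_m$ is the $\frac{m(m-1)}{2}\times 2^{m-1}$ matrix whose $k$-th column is the Column Pairwise Product of the $k$-th column of $T_m$. -}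

module Defs where

open import Data.Nat using (ℕ; zero; suc; _+_)
open import Data.Fin using (Fin; zero; suc; splitAt; inject₁; fromℕ)
open import Data.Integer using (ℤ; +_; -_; _*_)
open import Data.Sum using (_⊎_; inj₁; inj₂)
open import Data.Product using (_×_; _,_)

-- pow2 k = 2^k, defined so that Fin (pow2 (suc k)) = Fin (pow2 k + pow2 k)
-- splits into a first and second half (Data.Fin.splitAt).
pow2 : ℕ → ℕ
pow2 zero    = 1
pow2 (suc k) = pow2 k + pow2 k

-- tri m = m(m-1)/2, the number of pairs i < j in Fin m.
tri : ℕ → ℕ
tri zero    = 0
tri (suc m) = tri m + m

Mat : ℕ → ℕ → Set
Mat r c = Fin r → Fin c → ℤ

sylBlock : ∀ {n} → Mat n n → Mat (n + n) (n + n)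
sylBlock {n} A i j with splitAt n i | splitAt n j
... | inj₁ a | inj₁ b = A a b
... | inj₁ a | inj₂ b = A a b
... | inj₂ a | inj₁ b = A a b
... | inj₂ a | inj₂ b = - A a b

-- Sylvester k = H_{2^(k+1)}:  Sylvester 0 = H_2 = [[1,1],[1,-1]],
-- Sylvester (k+1) = [[H,H],[H,-H]] with H = Sylvester k.
H2 : Mat 2 2
H2 (suc zero) (suc zero) = - (+ 1)
H2 _ _ = + 1

Sylvester : (k : ℕ) → Mat (pow2 (suc k)) (pow2 (suc k))
Sylvester zero    = H2
Sylvester (suc k) = sylBlock (Sylvester k)

-- Case analysis on Fin (suc n): either inject₁ of some Fin n, or the last index.
lastView : ∀ {n} → Fin (suc n) → Fin n ⊎ Fin 1
lastView {zero}  zero    = inj₂ zero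
lastView {suc n} zero    = inj₁ zero
lastView {suc n} (suc i) with lastView {n} i
... | inj₁ a = inj₁ (suc a)
... | inj₂ b = inj₂ b

-- T n = T_{n+1}, an (n+1) × 2^n matrix.
-- T_1 = [1];  T_{m+1} = [[T_m, T_m], [1…1, -1…-1]].
T : (n : ℕ) → Mat (suc n) (pow2 n)
T zero    zero zero = + 1
T (suc n) i c with lastView i | splitAt (pow2 n) c
... | inj₁ r | inj₁ a = T n r a
... | inj₁ r | inj₂ b = T n r b
... | inj₂ _ | inj₁ _ = + 1
... | inj₂ _ | inj₂ _ = - (+ 1)

-- Decoding of pair positions: position (j-1)(j-2)/2 + i (1-based) ↦ (i , j), i < j.
-- Pairs with larger j come after all pairs with smaller j, ordered by i.
pairAt : (m : ℕ) → Fin (tri m) → Fin m × Fin m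
pairAt (suc m) p with splitAt (tri m) p
... | inj₁ q with pairAt m q
...   | (i , j) = (inject₁ i , inject₁ j)
pairAt (suc m) p | inj₂ i = (inject₁ i , fromℕ m)

cpp : ∀ {m} → (Fin m → ℤ) → Fin (tri m) → ℤ
cpp {m} v p with pairAt m p
... | (i , j) = v i * v j

-- CT n = CT_{n+1}: the k-th column is the CPP of the k-th column of T_{n+1}.
CT : (n : ℕ) → Mat (tri (suc n)) (pow2 n)
CT n p c = cpp (λ i → T n i c) p

-- The rows of H_{2^k} are the Walsh functions: the constant 1 for k = 0, and
-- otherwise (g, ±g) on the two halves for a Walsh function g of order k - 1.
-- Every row of T_m is of this form (rows of T_{m-1} are doubled with sign +,
-- the new last row is the constant 1 doubled with sign -), and Walsh functions
-- are closed under pointwise products because the doubling commutes with them.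
-- A row of CT_m is the pointwise product of two rows of T_m, hence a Walsh
-- function, hence a row of the Sylvester matrix.
module Submission where

open import Defs
open import Data.Nat using (ℕ; zero; suc; _+_)
open import Data.Fin using (Fin; zero; suc; splitAt; _↑ˡ_; _↑ʳ_)
open import Data.Fin.Properties using (splitAt-↑ˡ; splitAt-↑ʳ)
open import Data.Integer using (ℤ; +_; -_; _*_)
open import Data.Integer.Properties using (*-identityˡ; -1*i≡-i; *-commutativeSemigroup)
open import Algebra.Properties.CommutativeSemigroup *-commutativeSemigroup using (interchange)
open import Data.Sum using (_⊎_; inj₁; inj₂; [_,_]′)
open import Data.Product using (∃; _,_; proj₁; proj₂)
open import Relation.Binary.PropositionalEquality using (_≡_; refl; sym; trans; cong; cong₂)

Sign : ℤ → Set
Sign s = s ≡ + 1 ⊎ s ≡ - + 1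

Sign-* : ∀ {s t} → Sign s → Sign t → Sign (s * t)
Sign-* (inj₁ refl) (inj₁ refl) = inj₁ refl
Sign-* (inj₁ refl) (inj₂ refl) = inj₂ refl
Sign-* (inj₂ refl) (inj₁ refl) = inj₂ refl
Sign-* (inj₂ refl) (inj₂ refl) = inj₁ refl

doubling : ∀ {k} → (Fin k → ℤ) → ℤ → Fin (k + k) → ℤ
doubling {k} g s c = [ g , (λ b → s * g b) ]′ (splitAt k c)

doubling-cong : ∀ {k} {g h : Fin k → ℤ} s → (∀ c → g c ≡ h c) →
                ∀ c → doubling g s c ≡ doubling h s c
doubling-cong {k} s g≡h c with splitAt k c
... | inj₁ a = g≡h a
... | inj₂ b = cong (s *_) (g≡h b)

doubling-* : ∀ {k} (g h : Fin k → ℤ) s t c →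
             doubling g s c * doubling h t c ≡ doubling (λ b → g b * h b) (s * t) c
doubling-* {k} g h s t c with splitAt k c
... | inj₁ a = refl
... | inj₂ b = interchange s (g b) t (h b)

-- Stated up to pointwise equality, since there is no function extensionality.
data IsWalsh : (k : ℕ) → (Fin (pow2 k) → ℤ) → Set where
  constant : ∀ {f} → (∀ c → f c ≡ + 1) → IsWalsh 0 f
  doubled  : ∀ {k f g s} → Sign s → IsWalsh k g →
             (∀ c → f c ≡ doubling g s c) → IsWalsh (suc k) f

IsWalsh-one : ∀ k → IsWalsh k (λ _ → + 1)
IsWalsh-one zero    = constant (λ _ → refl)
IsWalsh-one (suc k) = doubled (inj₁ refl) (IsWalsh-one k) one≡doubling
  where
  one≡doubling : ∀ c → + 1 ≡ doubling {pow2 k} (λ _ → + 1) (+ 1) c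
  one≡doubling c with splitAt (pow2 k) c
  ... | inj₁ _ = refl
  ... | inj₂ _ = refl

IsWalsh-* : ∀ {k f h} → IsWalsh k f → IsWalsh k h → IsWalsh k (λ c → f c * h c)
IsWalsh-* (constant f≡1) (constant h≡1) = constant (λ c → cong₂ _*_ (f≡1 c) (h≡1 c))
IsWalsh-* (doubled {g = g} {s} sgn-s wg f≡) (doubled {g = g′} {t} sgn-t wg′ h≡) =
  doubled (Sign-* sgn-s sgn-t) (IsWalsh-* wg wg′)
    (λ c → trans (cong₂ _*_ (f≡ c) (h≡ c)) (doubling-* g g′ s t c))

T-suc : ∀ n i c → T (suc n) i c ≡
        [ (λ r → doubling (T n r) (+ 1) c) , (λ _ → doubling {pow2 n} (λ _ → + 1) (- + 1) c) ]′ (lastView i)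
T-suc n i c with lastView i | splitAt (pow2 n) c
... | inj₁ r | inj₁ a = refl
... | inj₁ r | inj₂ b = sym (*-identityˡ (T n r b))
... | inj₂ _ | inj₁ _ = refl
... | inj₂ _ | inj₂ _ = refl

IsWalsh-T : ∀ n i → IsWalsh n (T n i)
IsWalsh-T zero    zero = constant (λ { zero → refl })
IsWalsh-T (suc n) i with lastView i | T-suc n i
... | inj₁ r | T≡ = doubled (inj₁ refl) (IsWalsh-T n r) T≡
... | inj₂ _ | T≡ = doubled (inj₂ refl) (IsWalsh-one n) T≡

SylvesterRow : (n : ℕ) → (Fin (pow2 (suc n)) → ℤ) → Set
SylvesterRow n f = ∃ λ r → ∀ c → f c ≡ Sylvester n r c

SylvesterRow-resp : ∀ {n f g} → (∀ c → f c ≡ g c) → SylvesterRow n g → SylvesterRow n f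
SylvesterRow-resp f≡g (r , g≡) = r , λ c → trans (f≡g c) (g≡ c)

Sylvester-↑ˡ : ∀ n r c →
               Sylvester (suc n) (r ↑ˡ pow2 (suc n)) c ≡ doubling (Sylvester n r) (+ 1) c
Sylvester-↑ˡ n r c rewrite splitAt-↑ˡ (pow2 (suc n)) r (pow2 (suc n))
  with splitAt (pow2 (suc n)) c
... | inj₁ a = refl
... | inj₂ b = sym (*-identityˡ (Sylvester n r b))

Sylvester-↑ʳ : ∀ n r c →
               Sylvester (suc n) (pow2 (suc n) ↑ʳ r) c ≡ doubling (Sylvester n r) (- + 1) c
Sylvester-↑ʳ n r c rewrite splitAt-↑ʳ (pow2 (suc n)) (pow2 (suc n)) r
  with splitAt (pow2 (suc n)) c
... | inj₁ a = refl
... | inj₂ b = sym (-1*i≡-i (Sylvester n r b))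

SylvesterRow-doubling-one : ∀ {g : Fin 1 → ℤ} {s} → Sign s → (∀ c → g c ≡ + 1) → SylvesterRow 0 (doubling g s)
SylvesterRow-doubling-one {g} (inj₁ refl) g≡1 = zero , λ { zero → g≡1 zero ; (suc zero) → cong (+ 1 *_) (g≡1 zero) }
SylvesterRow-doubling-one {g} (inj₂ refl) g≡1 = suc zero , λ { zero → g≡1 zero ; (suc zero) → cong (- + 1 *_) (g≡1 zero) }

SylvesterRow-doubling : ∀ {n g s} → Sign s → SylvesterRow n g → SylvesterRow (suc n) (doubling g s)
SylvesterRow-doubling {n} {g} {s} (inj₁ refl) (r , g≡) =
  r ↑ˡ pow2 (suc n) , λ c → trans (doubling-cong s g≡ c) (sym (Sylvester-↑ˡ n r c))
SylvesterRow-doubling {n} {g} {s} (inj₂ refl) (r , g≡) =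
  pow2 (suc n) ↑ʳ r , λ c → trans (doubling-cong s g≡ c) (sym (Sylvester-↑ʳ n r c))

IsWalsh⇒SylvesterRow : ∀ n {f} → IsWalsh (suc n) f → SylvesterRow n f
IsWalsh⇒SylvesterRow zero    (doubled sgn (constant g≡1) f≡) =
  SylvesterRow-resp {0} f≡ (SylvesterRow-doubling-one sgn g≡1)
IsWalsh⇒SylvesterRow (suc n) (doubled sgn wg f≡) =
  SylvesterRow-resp {suc n} f≡ (SylvesterRow-doubling {n} sgn (IsWalsh⇒SylvesterRow n wg))

CT-pairAt : ∀ n p c → CT n p c ≡ T n (proj₁ (pairAt (suc n) p)) c * T n (proj₂ (pairAt (suc n) p)) c
CT-pairAt n p c with pairAt (suc n) p
... | _ = refl

mainTheorem5 : (n : ℕ) → (p : Fin (tri (suc (suc n)))) →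
    ∃ λ (r : Fin (pow2 (suc n))) → (c : Fin (pow2 (suc n))) → CT (suc n) p c ≡ Sylvester n r c
mainTheorem5 n p =
  SylvesterRow-resp {n} (CT-pairAt (suc n) p)
    (IsWalsh⇒SylvesterRow n (IsWalsh-* (IsWalsh-T (suc n) i) (IsWalsh-T (suc n) j)))
  where
  i j : Fin (suc (suc n))
  i = proj₁ (pairAt (suc (suc n)) p)
  j = proj₂ (pairAt (suc (suc n)) p)
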